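{- If $\mathrm{G}_{\mathbf{a}}(\mathbf{x};q)=\mathrm{L}_{\mathbf{a},\emptyset}(\mathbf{x};q)$ holds for all area sequences $\mathbf{a}$ (the unit-interval case), then $\mathrm{G}_{\mathbf{a},\mathbf{s}}(\mathbf{x};q)=\mathrm{L}_{\mathbf{a},\mathbf{s}}(\mathbf{x};q)$ holds for all vertical strip diagrams $\Gamma_{\mathbf{a},\mathbf{s}}$.
   Context: An area sequence is $\mathbf{a}=(a_1,\dotsc,a_n)$ with $0\le a_i\le i-1$ and $a_{i+1}\le a_i+1$; $\Gamma_\mathbf{a}$ has vertex set $[n]$ and directed edges $j\to i$ for $i-a_i\le j\le i-1$. An outer corner $(u,v)$, $u<v$, is a non-edge with $u+1=v$ or with $(u+1,v)$, $(u,v-1)$ both edges; a vertical strip diagram $\Gamma_{\mathbf{a},\mathbf{s}}$ is $\Gamma_\mathbf{a}$ plus a set $\mathbf{s}$ of outer corners (strict edges). Vertical strip LLT polynomial: $\mathrm{G}_{\mathbf{a},\mathbf{s}}(\mathbf{x};q)=\sum_\kappa\mathbf{x}^\kappa q^{\mathrm{asc}(\kappa)}$ over $\kappa:[n]\to\mathbb{N}$ with $\kappa(u)<\kappa(v)$ for strict $(u,v)$, where $\mathrm{asc}(\kappa)$ counts edges $(u,v)$ of $\Gamma_\mathbf{a}$ (not strict ones) with $\kappa(u)<\kappa(v)$; $\mathrm{G}_\mathbf{a}=\mathrm{G}_{\mathbf{a},\emptyset}$. $O(\mathbf{a},\mathbf{s})$ is the set of orientations of undirected $\Gamma_\mathbf{a}$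 plus the fixed strict edges $u\to v$; an edge of $\Gamma_\mathbf{a}$ is ascending if oriented from smaller to larger vertex (strict edges not ascending), $\mathrm{asc}(\theta)$ their number; $\mathrm{hrv}_\theta(u)$ is the maximal vertex reachable from $u$ using strict and ascending edges; $\pi(\theta)$ is the partition of block sizes of the set partition by equal $\mathrm{hrv}_\theta$. $\mathrm{L}_{\mathbf{a},\mathbf{s}}$ is defined by $\mathrm{L}_{\mathbf{a},\mathbf{s}}(\mathbf{x};q+1)=\sum_{\theta\in O(\mathbf{a},\mathbf{s})}q^{\mathrm{asc}(\theta)}\mathrm{e}_{\pi(\theta)}(\mathbf{x})$. -}

module Defs where

open import Data.Nat using (ℕ; zero; suc; _+_; _≤_; _<_; _⊔_; _≡ᵇ_; _<ᵇ_; _≤ᵇ_)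
open import Data.Integer using (ℤ; +_; -_) renaming (_+_ to _+ℤ_; _*_ to _*ℤ_)
open import Data.Fin using (Fin; toℕ)
open import Data.Bool using (Bool; true; false; _∧_; _∨_; if_then_else_; not)
open import Data.List using (List; []; _∷_; _++_; map; concatMap; allFin; filterᵇ; length; foldr; replicate)
open import Data.Bool.ListAction using (all; any)
open import Data.Product using (_×_; _,_; ∃; ∃₂; proj₁; proj₂)
open import Data.Sum using (_⊎_)
open import Relation.Binary.PropositionalEquality using (_≡_)
open import Relation.Nullary using (¬_)
import Data.Vec.Functional as VF

-- Polynomials in q with integer coefficients, as coefficient lists
-- (constant term first).  Equality is coefficientwise.

Poly : Set
Poly = List ℤ

coeff : Poly → ℕ → ℤ
coeff []       _       = + 0
coeff (c ∷ p)  zero    = c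
coeff (c ∷ p)  (suc k) = coeff p k

_≈P_ : Poly → Poly → Set
p ≈P r = ∀ k → coeff p k ≡ coeff r k

_⊕_ : Poly → Poly → Poly
[]      ⊕ r       = r
(c ∷ p) ⊕ []      = c ∷ p
(c ∷ p) ⊕ (d ∷ r) = (c +ℤ d) ∷ (p ⊕ r)

scale : ℤ → Poly → Poly
scale c = map (c *ℤ_)

_⊗_ : Poly → Poly → Poly
[]      ⊗ r = []
(c ∷ p) ⊗ r = scale c r ⊕ (+ 0 ∷ (p ⊗ r))

qPow : ℕ → Poly
qPow k = replicate k (+ 0) ++ (+ 1 ∷ [])

ΣP : List Poly → Poly
ΣP = foldr _⊕_ []

compose : Poly → Poly → Poly
compose []      r = []
compose (c ∷ p) r = (c ∷ []) ⊕ (r ⊗ compose p r)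

qMinus1 : Poly
qMinus1 = - (+ 1) ∷ + 1 ∷ []

countᵇ : {A : Set} → (A → Bool) → List A → ℕ
countᵇ p xs = length (filterᵇ p xs)

_==F_ : {n : ℕ} → Fin n → Fin n → Bool
i ==F j = toℕ i ≡ᵇ toℕ j

allFuns : (n N : ℕ) → List (Fin n → Fin N)
allFuns zero    N = (λ ()) ∷ []
allFuns (suc n) N = concatMap (λ c → map (λ f → c VF.∷ f) (allFuns n N)) (allFin N)

-- Area sequences (vertices 0,…,n-1 stand for the paper's 1,…,n)

record AreaSeq (n : ℕ) : Set where
  field
    area  : Fin n → ℕ
    bound : ∀ i → area i ≤ toℕ i                       -- a_i ≤ i - 1 (1-based)
    step  : ∀ i j → toℕ j ≡ suc (toℕ i) → area j ≤ suc (area i)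
open AreaSeq public

-- directed edge j → i of Γ_a :  i - a_i ≤ j ≤ i - 1
Edge : {n : ℕ} → AreaSeq n → Fin n → Fin n → Set
Edge a j i = toℕ j < toℕ i × toℕ i ≤ toℕ j + area a i

edgeᵇ : {n : ℕ} → AreaSeq n → Fin n → Fin n → Bool
edgeᵇ a j i = (toℕ j <ᵇ toℕ i) ∧ (toℕ i ≤ᵇ toℕ j + area a i)

OuterCorner : {n : ℕ} → AreaSeq n → Fin n → Fin n → Set
OuterCorner {n} a u v =
  toℕ u < toℕ v × ¬ Edge a u v ×
  ( suc (toℕ u) ≡ toℕ v
  ⊎ ∃₂ λ (u' v' : Fin n) → toℕ u' ≡ suc (toℕ u) × toℕ v ≡ suc (toℕ v') × Edge a u' v × Edge a u v')

StrictSet : {n : ℕ} → AreaSeq n → Set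
StrictSet {n} a = ∃ λ (s : Fin n → Fin n → Bool) → ∀ u v → s u v ≡ true → OuterCorner a u v

emptyStrict : {n : ℕ} (a : AreaSeq n) → StrictSet a
emptyStrict a = (λ _ _ → false) , λ u v ()

edgeList : {n : ℕ} → AreaSeq n → List (Fin n × Fin n)
edgeList {n} a = concatMap (λ j → map (λ i → j , i) (filterᵇ (edgeᵇ a j) (allFin n))) (allFin n)

-- x-monomials: for N variables x_0,…,x_{N-1}, an exponent vector α : Fin N → ℕ.
-- content κ = α  iff  x^κ = x^α

contentIs : {n N : ℕ} → (Fin n → Fin N) → (Fin N → ℕ) → Bool
contentIs {n} {N} κ α = all (λ i → countᵇ (λ u → κ u ==F i) (allFin n) ≡ᵇ α i) (allFin N)

-- Vertical strip LLT polynomial: coefficient of x^α (a polynomial in q)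

ascκ : {n N : ℕ} → AreaSeq n → (Fin n → Fin N) → ℕ
ascκ a κ = countᵇ (λ e → toℕ (κ (proj₁ e)) <ᵇ toℕ (κ (proj₂ e))) (edgeList a)

respectsStrict : {n N : ℕ} → (Fin n → Fin n → Bool) → (Fin n → Fin N) → Bool
respectsStrict {n} s κ =
  all (λ u → all (λ v → not (s u v) ∨ (toℕ (κ u) <ᵇ toℕ (κ v))) (allFin n)) (allFin n)

GCoeff : {n : ℕ} (a : AreaSeq n) → StrictSet a → {N : ℕ} → (Fin N → ℕ) → Poly
GCoeff {n} a s {N} α =
  ΣP (map (λ κ → qPow (ascκ a κ))
          (filterᵇ (λ κ → respectsStrict (proj₁ s) κ ∧ contentIs κ α) (allFuns n N)))

-- Orientations of Γ_a: each edge (j , i), j < i, gets a Bool,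
-- true = ascending (oriented j → i), false = descending (i → j).

allAssign : {X : Set} → List X → List (List (X × Bool))
allAssign []       = [] ∷ []
allAssign (e ∷ es) = concatMap (λ r → ((e , true) ∷ r) ∷ ((e , false) ∷ r) ∷ []) (allAssign es)

Orientation : ℕ → Set
Orientation n = List ((Fin n × Fin n) × Bool)

orientations : {n : ℕ} → AreaSeq n → List (Orientation n)
orientations a = allAssign (edgeList a)

ascθ : {n : ℕ} → Orientation n → ℕ
ascθ θ = countᵇ proj₂ θ

stepθ : {n : ℕ} → (Fin n → Fin n → Bool) → Orientation n → Fin n → Fin n → Bool
stepθ s θ u v = s u v ∨ any (λ e → proj₂ e ∧ (proj₁ (proj₁ e) ==F u) ∧ (proj₂ (proj₁ e) ==F v)) θ

reachIn : {n : ℕ} → ℕ → (Fin n → Fin n → Bool) → Fin n → Fin n → Bool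
reachIn         zero    st u w = u ==F w
reachIn {n} (suc k) st u w = reachIn k st u w ∨ any (λ v → st u v ∧ reachIn k st v w) (allFin n)

hrv : {n : ℕ} → (Fin n → Fin n → Bool) → Orientation n → Fin n → ℕ
hrv {n} s θ u = foldr _⊔_ 0 (map (λ w → if reachIn n (stepθ s θ) u w then toℕ w else 0) (allFin n))

-- coefficient of x^α in e_{π(θ)}(x_0,…,x_{N-1}) = Π_{blocks B} e_{|B|}:
-- the number of κ with x^κ = x^α that are strictly increasing on every block.
eπCoeff : {n : ℕ} → (Fin n → Fin n → Bool) → Orientation n → {N : ℕ} → (Fin N → ℕ) → ℕ
eπCoeff {n} s θ {N} α = countᵇ ok (allFuns n N)
  where
  ok : (Fin n → Fin N) → Bool
  ok κ = contentIs κ α ∧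
    all (λ u → all (λ v → not ((toℕ u <ᵇ toℕ v) ∧ (hrv s θ u ≡ᵇ hrv s θ v))
                          ∨ (toℕ (κ u) <ᵇ toℕ (κ v))) (allFin n)) (allFin n)

-- coefficient of x^α in L_{a,s}(x; q+1) = Σ_θ q^{asc θ} e_{π(θ)}
LShiftedCoeff : {n : ℕ} (a : AreaSeq n) → StrictSet a → {N : ℕ} → (Fin N → ℕ) → Poly
LShiftedCoeff a s α = ΣP (map (λ θ → scale (+ eπCoeff (proj₁ s) θ α) (qPow (ascθ θ))) (orientations a))

-- coefficient of x^α in L_{a,s}(x; q), obtained by substituting q ↦ q - 1
LCoeff : {n : ℕ} (a : AreaSeq n) → StrictSet a → {N : ℕ} → (Fin N → ℕ) → Poly
LCoeff a s α = compose (LShiftedCoeff a s α) qMinus1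

-- Equality of the symmetric functions G_{a,s} and L_{a,s}:
-- equal coefficients of every monomial x^α (every monomial involves finitely many variables).

G≡L : {n : ℕ} (a : AreaSeq n) → StrictSet a → Set
G≡L a s = ∀ (N : ℕ) (α : Fin N → ℕ) → GCoeff a s α ≈P LCoeff a s α

module Submission where

-- Induction on the strict set s.  A strict edge (u , v) ∈ s is an outer corner of Γ_a; let a⁺ be a
-- with a_v raised by one, so that Γ_{a⁺} is Γ_a plus the single edge u → v, and s⁻ = s ∖ (u , v).
-- Both sides obey the same deletion-contraction recurrence
--     X_{a⁺,s⁻} = X_{a,s⁻} + (q - 1) · X_{a,s}        (X = G or L):
-- for G, a colouring gains the ascent u → v exactly when it respects the strict edge (u , v);
-- for L, orienting the new edge v → u leaves the reachability relation of s⁻ unchanged, while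
-- orienting it u → v adds one ascent and makes it act exactly like the strict edge (u , v).
-- The pairs s⁻ are outer corners of both a and a⁺, so by induction G = L for (a, s⁻) and
-- (a⁺, s⁻); hence (q - 1)·G_{a,s} = (q - 1)·L_{a,s}, and q - 1 is not a zero divisor.

open import Defs
open import Data.Nat using (ℕ; zero; suc; _+_; _≤_; _<_; _<ᵇ_; _≡ᵇ_; _⊔_; z≤n; s≤s)
import Data.Nat.Properties as ℕP
open import Data.Integer using (ℤ; +_; -_; _-_) renaming (_+_ to _+ℤ_; _*_ to _*ℤ_)
import Data.Integer.Properties as ℤP
open import Data.Integer.Tactic.RingSolver using (solve-∀)
open import Algebra.Properties.AbelianGroup ℤP.+-0-abelianGroup using (∙-cancelˡ)
open import Algebra.Properties.CommutativeSemigroup ℤP.+-commutativeSemigroup using (interchange)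
open import Data.Fin using (Fin; toℕ; zero; suc)
import Data.Fin.Properties as FinP
open import Data.Bool using (Bool; true; false; T; T?; _∧_; _∨_; not; if_then_else_)
import Data.Bool.Properties as BoolP
open import Data.Bool.ListAction using (all; any; and)
open import Data.List using (List; []; _∷_; _++_; map; foldr; concat; concatMap; filterᵇ; length; tabulate; allFin; cartesianProduct)
import Data.List.Properties as List
open import Data.List.Relation.Binary.Permutation.Propositional using (_↭_; prep; swap; ↭-reflexive)
  renaming (refl to ↭refl; trans to ↭trans)
open import Data.List.Relation.Binary.Permutation.Propositional.Properties using (↭-length; filter-↭; map⁺; ++⁺; shift)
open import Data.List.Membership.Propositional using (_∈_)
open import Data.List.Membership.Propositional.Properties using (∈-allFin; ∈-cartesianProduct⁺)
open import Data.List.Relation.Unary.Any using (here; there)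
open import Data.Product using (_×_; _,_; proj₁; proj₂)
open import Data.Sum using (inj₁; inj₂)
open import Data.Empty using (⊥-elim)
open import Relation.Nullary using (¬_)
open import Function using (_∘_; id)
open import Relation.Binary.PropositionalEquality
open ≡-Reasoning

q· : (ℕ → ℤ) → ℕ → ℤ
q· f zero    = + 0
q· f (suc k) = f k

Δ : (ℕ → ℤ) → ℕ → ℤ
Δ f k = q· f k - f k

q·-cong : ∀ {f g} → f ≗ g → q· f ≗ q· g
q·-cong e zero    = refl
q·-cong e (suc k) = e k

Δ-cong : ∀ {f g} → f ≗ g → Δ f ≗ Δ g
Δ-cong e k = cong₂ _-_ (q·-cong e k) (e k)

-- q - 1 is not a zero divisor: a sequence is determined by its product with q - 1,
-- because its k-th coefficient is recovered from the (k-1)-st.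
Δ-injective : ∀ f g → Δ f ≗ Δ g → f ≗ g
Δ-injective f g e k = ℤP.neg-injective (∙-cancelˡ (q· f k) (- f k) (- g k)
  (trans (e k) (cong (_- g k) (sym (q·-agree k)))))
  where
  q·-agree : q· f ≗ q· g
  q·-agree zero    = refl
  q·-agree (suc k) = Δ-injective f g e k

q·-split : ∀ f k → q· f k ≡ f k +ℤ Δ f k
q·-split f k = lemma (q· f k) (f k)
  where
  lemma : ∀ x y → x ≡ y +ℤ (x - y)
  lemma = solve-∀

record Additive (T : (ℕ → ℤ) → ℕ → ℤ) : Set where
  field
    T-cong : ∀ {f g} → f ≗ g → T f ≗ T g
    T-+    : ∀ f g k → T (λ j → f j +ℤ g j) k ≡ T f k +ℤ T g k
    T-0    : ∀ k → T (λ _ → + 0) k ≡ + 0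

q·-additive : Additive q·
q·-additive = record { T-cong = q·-cong ; T-+ = q·-+ ; T-0 = q·-0 }
  where
  q·-+ : ∀ f g k → q· (λ j → f j +ℤ g j) k ≡ q· f k +ℤ q· g k
  q·-+ f g zero    = refl
  q·-+ f g (suc k) = refl
  q·-0 : ∀ k → q· (λ _ → + 0) k ≡ + 0
  q·-0 zero    = refl
  q·-0 (suc k) = refl

Δ-additive : Additive Δ
Δ-additive = record { T-cong = Δ-cong ; T-+ = Δ-+ ; T-0 = Δ-0 }
  where
  open Additive q·-additive
  Δ-+ : ∀ f g k → Δ (λ j → f j +ℤ g j) k ≡ Δ f k +ℤ Δ g k
  Δ-+ f g k = trans (cong (_- (f k +ℤ g k)) (T-+ f g k)) (regroup (q· f k) (q· g k) (f k) (g k))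
    where
    regroup : ∀ a b c d → (a +ℤ b) - (c +ℤ d) ≡ (a - c) +ℤ (b - d)
    regroup = solve-∀
  Δ-0 : ∀ k → Δ (λ _ → + 0) k ≡ + 0
  Δ-0 k = cong (_- + 0) (T-0 k)

coeff-⊕ : ∀ p r k → coeff (p ⊕ r) k ≡ coeff p k +ℤ coeff r k
coeff-⊕ []      r       k       = sym (ℤP.+-identityˡ _)
coeff-⊕ (c ∷ p) []      k       = sym (ℤP.+-identityʳ _)
coeff-⊕ (c ∷ p) (d ∷ r) zero    = refl
coeff-⊕ (c ∷ p) (d ∷ r) (suc k) = coeff-⊕ p r k

coeff-scale : ∀ c p k → coeff (scale c p) k ≡ c *ℤ coeff p k
coeff-scale c []      k       = sym (ℤP.*-zeroʳ c)
coeff-scale c (d ∷ p) zero    = refl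
coeff-scale c (d ∷ p) (suc k) = coeff-scale c p k

coeff-0∷ : ∀ p → coeff (+ 0 ∷ p) ≗ q· (coeff p)
coeff-0∷ p zero    = refl
coeff-0∷ p (suc k) = refl

coeff-scale-0∷ : ∀ c p → coeff (scale c (+ 0 ∷ p)) ≗ q· (coeff (scale c p))
coeff-scale-0∷ c p zero    = ℤP.*-zeroʳ c
coeff-scale-0∷ c p (suc k) = refl

coeff-const-+ : ∀ c d k → coeff ((c +ℤ d) ∷ []) k ≡ coeff (c ∷ []) k +ℤ coeff (d ∷ []) k
coeff-const-+ c d zero    = refl
coeff-const-+ c d (suc k) = refl

coeff-const-0 : ∀ k → coeff (+ 0 ∷ []) k ≡ + 0
coeff-const-0 zero    = refl
coeff-const-0 (suc k) = refl

coeff-1⊗ : ∀ r → coeff ((+ 1 ∷ []) ⊗ r) ≗ coeff r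
coeff-1⊗ r k = begin
  coeff (scale (+ 1) r ⊕ (+ 0 ∷ [])) k          ≡⟨ coeff-⊕ (scale (+ 1) r) (+ 0 ∷ []) k ⟩
  coeff (scale (+ 1) r) k +ℤ coeff (+ 0 ∷ []) k ≡⟨ cong₂ _+ℤ_ (coeff-scale (+ 1) r k) (coeff-const-0 k) ⟩
  + 1 *ℤ coeff r k +ℤ + 0                        ≡⟨ ℤP.+-identityʳ _ ⟩
  + 1 *ℤ coeff r k                               ≡⟨ ℤP.*-identityˡ _ ⟩
  coeff r k                                      ∎

coeff-q-1⊗ : ∀ r → coeff (qMinus1 ⊗ r) ≗ Δ (coeff r)
coeff-q-1⊗ r k = begin
  coeff (scale (- + 1) r ⊕ (+ 0 ∷ ((+ 1 ∷ []) ⊗ r))) k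
    ≡⟨ coeff-⊕ (scale (- + 1) r) (+ 0 ∷ ((+ 1 ∷ []) ⊗ r)) k ⟩
  coeff (scale (- + 1) r) k +ℤ coeff (+ 0 ∷ ((+ 1 ∷ []) ⊗ r)) k
    ≡⟨ cong₂ _+ℤ_ (trans (coeff-scale (- + 1) r k) (ℤP.-1*i≡-i _))
                  (trans (coeff-0∷ _ k) (q·-cong (coeff-1⊗ r) k)) ⟩
  - coeff r k +ℤ q· (coeff r) k
    ≡⟨ ℤP.+-comm (- coeff r k) (q· (coeff r) k) ⟩
  Δ (coeff r) k ∎

atQ-1 : Poly → Poly
atQ-1 p = compose p qMinus1

atQ-1-∷ : ∀ c p k → coeff (atQ-1 (c ∷ p)) k ≡ coeff (c ∷ []) k +ℤ Δ (coeff (atQ-1 p)) k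
atQ-1-∷ c p k = trans (coeff-⊕ (c ∷ []) (qMinus1 ⊗ atQ-1 p) k)
                      (cong (coeff (c ∷ []) k +ℤ_) (coeff-q-1⊗ (atQ-1 p) k))

atQ-1-zero : ∀ p → coeff p ≗ (λ _ → + 0) → coeff (atQ-1 p) ≗ (λ _ → + 0)
atQ-1-zero []      e k = refl
atQ-1-zero (c ∷ p) e k = begin
  coeff (atQ-1 (c ∷ p)) k                         ≡⟨ atQ-1-∷ c p k ⟩
  coeff (c ∷ []) k +ℤ Δ (coeff (atQ-1 p)) k       ≡⟨ cong₂ _+ℤ_ (trans (cong (λ z → coeff (z ∷ []) k) (e zero)) (coeff-const-0 k))
                                                                 (T-cong (atQ-1-zero p (λ j → e (suc j))) k) ⟩
  + 0 +ℤ Δ (λ _ → + 0) k                          ≡⟨ cong (+ 0 +ℤ_) (T-0 k) ⟩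
  + 0                                             ∎
  where open Additive Δ-additive

atQ-1-cong : ∀ p r → coeff p ≗ coeff r → coeff (atQ-1 p) ≗ coeff (atQ-1 r)
atQ-1-cong []      r       e k = sym (atQ-1-zero r (λ j → sym (e j)) k)
atQ-1-cong (c ∷ p) []      e k = atQ-1-zero (c ∷ p) e k
atQ-1-cong (c ∷ p) (d ∷ r) e k = begin
  coeff (atQ-1 (c ∷ p)) k                      ≡⟨ atQ-1-∷ c p k ⟩
  coeff (c ∷ []) k +ℤ Δ (coeff (atQ-1 p)) k    ≡⟨ cong₂ _+ℤ_ (cong (λ z → coeff (z ∷ []) k) (e zero))
                                                              (Δ-cong (atQ-1-cong p r (λ j → e (suc j))) k) ⟩
  coeff (d ∷ []) k +ℤ Δ (coeff (atQ-1 r)) k    ≡⟨ atQ-1-∷ d r k ⟨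
  coeff (atQ-1 (d ∷ r)) k                      ∎

atQ-1-⊕ : ∀ p r k → coeff (atQ-1 (p ⊕ r)) k ≡ coeff (atQ-1 p) k +ℤ coeff (atQ-1 r) k
atQ-1-⊕ []      r       k = sym (ℤP.+-identityˡ _)
atQ-1-⊕ (c ∷ p) []      k = sym (ℤP.+-identityʳ _)
atQ-1-⊕ (c ∷ p) (d ∷ r) k = begin
  coeff (atQ-1 ((c +ℤ d) ∷ (p ⊕ r))) k
    ≡⟨ atQ-1-∷ (c +ℤ d) (p ⊕ r) k ⟩
  coeff ((c +ℤ d) ∷ []) k +ℤ Δ (coeff (atQ-1 (p ⊕ r))) k
    ≡⟨ cong₂ _+ℤ_ (coeff-const-+ c d k)
                  (trans (T-cong (atQ-1-⊕ p r) k) (T-+ (coeff (atQ-1 p)) (coeff (atQ-1 r)) k)) ⟩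
  (coeff (c ∷ []) k +ℤ coeff (d ∷ []) k) +ℤ (Δ (coeff (atQ-1 p)) k +ℤ Δ (coeff (atQ-1 r)) k)
    ≡⟨ interchange (coeff (c ∷ []) k) (coeff (d ∷ []) k) (Δ (coeff (atQ-1 p)) k) (Δ (coeff (atQ-1 r)) k) ⟩
  (coeff (c ∷ []) k +ℤ Δ (coeff (atQ-1 p)) k) +ℤ (coeff (d ∷ []) k +ℤ Δ (coeff (atQ-1 r)) k)
    ≡⟨ cong₂ _+ℤ_ (atQ-1-∷ c p k) (atQ-1-∷ d r k) ⟨
  coeff (atQ-1 (c ∷ p)) k +ℤ coeff (atQ-1 (d ∷ r)) k ∎
  where open Additive Δ-additive

atQ-1-q· : ∀ p → coeff (atQ-1 (+ 0 ∷ p)) ≗ Δ (coeff (atQ-1 p))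
atQ-1-q· p k = trans (atQ-1-∷ (+ 0) p k)
                     (trans (cong (_+ℤ Δ (coeff (atQ-1 p)) k) (coeff-const-0 k)) (ℤP.+-identityˡ _))

sumOver : {A : Set} → List A → (A → ℤ) → ℤ
sumOver xs f = foldr (λ x acc → f x +ℤ acc) (+ 0) xs

sum-cong : {A : Set} (xs : List A) {f g : A → ℤ} → (∀ x → f x ≡ g x) → sumOver xs f ≡ sumOver xs g
sum-cong []       e = refl
sum-cong (x ∷ xs) e = cong₂ _+ℤ_ (e x) (sum-cong xs e)

sum-++ : {A : Set} (xs ys : List A) (f : A → ℤ) → sumOver (xs ++ ys) f ≡ sumOver xs f +ℤ sumOver ys f
sum-++ []       ys f = sym (ℤP.+-identityˡ _)
sum-++ (x ∷ xs) ys f = trans (cong (f x +ℤ_) (sum-++ xs ys f)) (sym (ℤP.+-assoc (f x) _ _))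

sum-concatMap : {A B : Set} (g : A → List B) (xs : List A) (f : B → ℤ) →
  sumOver (concatMap g xs) f ≡ sumOver xs (λ x → sumOver (g x) f)
sum-concatMap g []       f = refl
sum-concatMap g (x ∷ xs) f =
  trans (sum-++ (g x) (concatMap g xs) f) (cong (sumOver (g x) f +ℤ_) (sum-concatMap g xs f))

sum-+ : {A : Set} (xs : List A) (f g : A → ℤ) →
  sumOver xs (λ x → f x +ℤ g x) ≡ sumOver xs f +ℤ sumOver xs g
sum-+ []       f g = refl
sum-+ (x ∷ xs) f g = trans (cong (f x +ℤ g x +ℤ_) (sum-+ xs f g)) (interchange (f x) (g x) _ _)

sum-commute : ∀ {T : (ℕ → ℤ) → ℕ → ℤ} → Additive T → {A : Set} (xs : List A) (h : A → ℕ → ℤ) (k : ℕ) →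
  sumOver xs (λ x → T (h x) k) ≡ T (λ j → sumOver xs (λ x → h x j)) k
sum-commute lin []       h k = sym (Additive.T-0 lin k)
sum-commute {T} lin (x ∷ xs) h k =
  trans (cong (T (h x) k +ℤ_) (sum-commute lin xs h k))
        (sym (Additive.T-+ lin (h x) (λ j → sumOver xs (λ y → h y j)) k))

sum-filter : {A : Set} (p : A → Bool) (xs : List A) (f : A → ℤ) →
  sumOver (filterᵇ p xs) f ≡ sumOver xs (λ x → if p x then f x else + 0)
sum-filter p []       f = refl
sum-filter p (x ∷ xs) f with p x
... | true  = cong (f x +ℤ_) (sum-filter p xs f)
... | false = trans (sum-filter p xs f) (sym (ℤP.+-identityˡ _))

coeff-ΣP : {A : Set} (F : A → Poly) (xs : List A) (k : ℕ) →
  coeff (ΣP (map F xs)) k ≡ sumOver xs (λ x → coeff (F x) k)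
coeff-ΣP F []       k = refl
coeff-ΣP F (x ∷ xs) k = trans (coeff-⊕ (F x) _ k) (cong (coeff (F x) k +ℤ_) (coeff-ΣP F xs k))

countᵇ-∷ : {A : Set} (p : A → Bool) (x : A) (xs : List A) →
  countᵇ p (x ∷ xs) ≡ (if p x then suc (countᵇ p xs) else countᵇ p xs)
countᵇ-∷ p x xs with p x
... | true  = refl
... | false = refl

filterᵇ-cong : {A : Set} {p q : A → Bool} → (∀ x → p x ≡ q x) → ∀ xs → filterᵇ p xs ≡ filterᵇ q xs
filterᵇ-cong e []       = refl
filterᵇ-cong {p = p} {q} e (x ∷ xs) with p x | q x | e x
... | true  | .true  | refl = cong (x ∷_) (filterᵇ-cong e xs)
... | false | .false | refl = filterᵇ-cong e xs

countᵇ-cong : {A : Set} {p q : A → Bool} → (∀ x → p x ≡ q x) → ∀ xs → countᵇ p xs ≡ countᵇ q xs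
countᵇ-cong e xs = cong length (filterᵇ-cong e xs)

countᵇ-↭ : {A : Set} (p : A → Bool) {xs ys : List A} → xs ↭ ys → countᵇ p xs ≡ countᵇ p ys
countᵇ-↭ p xs↭ys = ↭-length (filter-↭ (T? ∘ p) xs↭ys)

any-↭ : {A : Set} (p : A → Bool) {xs ys : List A} → xs ↭ ys → any p xs ≡ any p ys
any-↭ p ↭refl          = refl
any-↭ p (prep x xs↭ys) = cong (p x ∨_) (any-↭ p xs↭ys)
any-↭ p (swap x y xs↭ys) with p x | p y
... | true  | true  = refl
... | true  | false = refl
... | false | true  = refl
... | false | false = any-↭ p xs↭ys
any-↭ p (↭trans xs↭ys ys↭zs) = trans (any-↭ p xs↭ys) (any-↭ p ys↭zs)

all-cong : {A : Set} {p q : A → Bool} (xs : List A) → (∀ x → p x ≡ q x) → all p xs ≡ all q xs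
all-cong xs e = cong (foldr _∧_ true) (List.map-cong e xs)

any-cong : {A : Set} {p q : A → Bool} (xs : List A) → (∀ x → p x ≡ q x) → any p xs ≡ any q xs
any-cong xs e = cong (foldr _∨_ false) (List.map-cong e xs)

labelSum : {X : Set} → List X → (List (X × Bool) → ℤ) → ℤ
labelSum L f = sumOver (allAssign L) f

labelSum-∷ : {X : Set} (x : X) (L : List X) (f : List (X × Bool) → ℤ) →
  labelSum (x ∷ L) f ≡ labelSum L (λ r → f ((x , true) ∷ r) +ℤ f ((x , false) ∷ r))
labelSum-∷ x L f =
  trans (sum-concatMap (λ r → ((x , true) ∷ r) ∷ ((x , false) ∷ r) ∷ []) (allAssign L) f)
        (sum-cong (allAssign L) (λ r → cong (f ((x , true) ∷ r) +ℤ_) (ℤP.+-identityʳ _)))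

PermInvariant : {X : Set} → (List (X × Bool) → ℤ) → Set
PermInvariant f = ∀ {θ θ'} → θ ↭ θ' → f θ ≡ f θ'

labelSum-↭ : {X : Set} {L L' : List X} → L ↭ L' → (f : List (X × Bool) → ℤ) → PermInvariant f →
  labelSum L f ≡ labelSum L' f
labelSum-↭ ↭refl f inv = refl
labelSum-↭ {L = x ∷ L} {x ∷ L'} (prep x L↭L') f inv =
  trans (labelSum-∷ x L f)
        (trans (labelSum-↭ L↭L' _ (λ p → cong₂ _+ℤ_ (inv (prep _ p)) (inv (prep _ p))))
               (sym (labelSum-∷ x L' f)))
labelSum-↭ {L = x ∷ y ∷ L} {y ∷ x ∷ L'} (swap x y L↭L') f inv = begin
  labelSum (x ∷ y ∷ L) f           ≡⟨ trans (labelSum-∷ x (y ∷ L) f) (labelSum-∷ y L (pair x)) ⟩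
  labelSum L (both x y)            ≡⟨ labelSum-↭ L↭L' (both x y) both-inv ⟩
  labelSum L' (both x y)           ≡⟨ sum-cong (allAssign L') both-swap ⟩
  labelSum L' (both y x)           ≡⟨ trans (labelSum-∷ y (x ∷ L') f) (labelSum-∷ x L' (pair y)) ⟨
  labelSum (y ∷ x ∷ L') f          ∎
  where
  pair : _ → List (_ × Bool) → ℤ
  pair a r = f ((a , true) ∷ r) +ℤ f ((a , false) ∷ r)
  both : _ → _ → List (_ × Bool) → ℤ
  both a b r = pair a ((b , true) ∷ r) +ℤ pair a ((b , false) ∷ r)
  both-inv : PermInvariant (both x y)
  both-inv p = cong₂ _+ℤ_ (cong₂ _+ℤ_ (inv (prep _ (prep _ p))) (inv (prep _ (prep _ p))))
                          (cong₂ _+ℤ_ (inv (prep _ (prep _ p))) (inv (prep _ (prep _ p))))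
  both-swap : ∀ r → both x y r ≡ both y x r
  both-swap r = trans (interchange (f ((x , true) ∷ (y , true) ∷ r)) (f ((x , false) ∷ (y , true) ∷ r))
                                   (f ((x , true) ∷ (y , false) ∷ r)) (f ((x , false) ∷ (y , false) ∷ r)))
    (cong₂ _+ℤ_ (cong₂ _+ℤ_ (inv (swap _ _ ↭refl)) (inv (swap _ _ ↭refl)))
                (cong₂ _+ℤ_ (inv (swap _ _ ↭refl)) (inv (swap _ _ ↭refl))))
labelSum-↭ (↭trans L↭L' L'↭L'') f inv = trans (labelSum-↭ L↭L' f inv) (labelSum-↭ L'↭L'' f inv)

∧-split : ∀ {a b} → a ∧ b ≡ true → a ≡ true × b ≡ true
∧-split {true} {true} _ = refl , refl

bool-ext : ∀ {b c} → (b ≡ true → c ≡ true) → (c ≡ true → b ≡ true) → b ≡ c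
bool-ext {true}  {true}  f g = refl
bool-ext {true}  {false} f g = sym (f refl)
bool-ext {false} {true}  f g = g refl
bool-ext {false} {false} f g = refl

==F-sound : ∀ {n} (i j : Fin n) → (i ==F j) ≡ true → i ≡ j
==F-sound zero    zero    e = refl
==F-sound (suc i) (suc j) e = cong suc (==F-sound i j e)

==F-refl : ∀ {n} (i : Fin n) → (i ==F i) ≡ true
==F-refl zero    = refl
==F-refl (suc i) = ==F-refl i

==F-false : ∀ {n} (i j : Fin n) → (i ==F j) ≡ false → ¬ (i ≡ j)
==F-false i .i e refl with () ← trans (sym (==F-refl i)) e

all-allFin⁻ : ∀ {n} (p : Fin n → Bool) → all p (allFin n) ≡ true → ∀ x → p x ≡ true
all-allFin⁻ {n} p e = go n p (trans (sym (cong and (List.map-tabulate id p))) e)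
  where
  go : ∀ m (p : Fin m → Bool) → and (tabulate p) ≡ true → ∀ x → p x ≡ true
  go (suc m) p e zero    = proj₁ (∧-split e)
  go (suc m) p e (suc x) = go m (p ∘ suc) (proj₂ (∧-split e)) x

all-allFin⁺ : ∀ {n} (p : Fin n → Bool) → (∀ x → p x ≡ true) → all p (allFin n) ≡ true
all-allFin⁺ {n} p h = trans (cong and (List.map-tabulate id p)) (go n p h)
  where
  go : ∀ m (p : Fin m → Bool) → (∀ x → p x ≡ true) → and (tabulate p) ≡ true
  go zero    p h = refl
  go (suc m) p h rewrite h zero = go m (p ∘ suc) (h ∘ suc)

Rel : ℕ → Set
Rel n = Fin n → Fin n → Bool

_≗R_ : ∀ {n} → Rel n → Rel n → Set
s ≗R s' = ∀ x y → s x y ≡ s' x y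

Respects : ∀ {n N} → Rel n → (Fin n → Fin N) → Set
Respects s κ = ∀ x y → s x y ≡ true → (toℕ (κ x) <ᵇ toℕ (κ y)) ≡ true

respects-sound : ∀ {n N} (s : Rel n) (κ : Fin n → Fin N) →
  respectsStrict s κ ≡ true → Respects s κ
respects-sound s κ e x y sxy =
  subst (λ b → not b ∨ (toℕ (κ x) <ᵇ toℕ (κ y)) ≡ true) sxy
        (all-allFin⁻ _ (all-allFin⁻ _ e x) y)

respects-complete : ∀ {n N} (s : Rel n) (κ : Fin n → Fin N) →
  Respects s κ → respectsStrict s κ ≡ true
respects-complete s κ r = all-allFin⁺ _ λ x → all-allFin⁺ _ λ y → implication x y
  where
  implication : ∀ x y → not (s x y) ∨ (toℕ (κ x) <ᵇ toℕ (κ y)) ≡ true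
  implication x y with s x y in sxy
  ... | true  = r x y sxy
  ... | false = refl

filter-tabulate-cong : ∀ {A : Set} n (h : Fin n → A) {f g : A → Bool} →
  (∀ x → f (h x) ≡ g (h x)) → filterᵇ f (tabulate h) ≡ filterᵇ g (tabulate h)
filter-tabulate-cong zero    h e = refl
filter-tabulate-cong (suc n) h {f} {g} e with f (h zero) | g (h zero) | e zero
... | true  | .true  | refl = cong (h zero ∷_) (filter-tabulate-cong n (h ∘ suc) (e ∘ suc))
... | false | .false | refl = filter-tabulate-cong n (h ∘ suc) (e ∘ suc)

filter-point : ∀ {A : Set} n (h : Fin n → A) (f g : A → Bool) (v : Fin n) →
  (∀ x → (x ==F v) ≡ false → f (h x) ≡ g (h x)) → g (h v) ≡ true → f (h v) ≡ false →
  filterᵇ g (tabulate h) ↭ h v ∷ filterᵇ f (tabulate h)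
filter-point (suc n) h f g zero e gv fv rewrite gv | fv =
  prep (h zero) (↭-reflexive (filter-tabulate-cong n (h ∘ suc) (λ x → sym (e (suc x) refl))))
filter-point (suc n) h f g (suc v) e gv fv with f (h zero) | g (h zero) | e zero refl
... | true  | .true  | refl = ↭trans (prep (h zero) rest) (swap (h zero) (h (suc v)) ↭refl)
  where rest = filter-point n (h ∘ suc) f g v (e ∘ suc) gv fv
... | false | .false | refl = filter-point n (h ∘ suc) f g v (e ∘ suc) gv fv

concat-tabulate-cong : ∀ {A : Set} n (B B' : Fin n → List A) → (∀ j → B j ↭ B' j) →
  concat (tabulate B) ↭ concat (tabulate B')
concat-tabulate-cong zero    B B' e = ↭refl
concat-tabulate-cong (suc n) B B' e = ++⁺ (e zero) (concat-tabulate-cong n (B ∘ suc) (B' ∘ suc) (e ∘ suc))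

concat-point : ∀ {A : Set} n (B B' : Fin n → List A) (u : Fin n) (x : A) →
  (∀ j → (j ==F u) ≡ false → B j ↭ B' j) → B u ↭ x ∷ B' u →
  concat (tabulate B) ↭ x ∷ concat (tabulate B')
concat-point (suc n) B B' zero x e eu =
  ++⁺ eu (concat-tabulate-cong n (B ∘ suc) (B' ∘ suc) (λ j → e (suc j) refl))
concat-point (suc n) B B' (suc u) x e eu =
  ↭trans (++⁺ (e zero refl) (concat-point n (B ∘ suc) (B' ∘ suc) u x (e ∘ suc) eu))
         (shift x (B' zero) _)

edgeᵇ-sound : ∀ {n} (a : AreaSeq n) j i → edgeᵇ a j i ≡ true → Edge a j i
edgeᵇ-sound a j i e with e₁ , e₂ ← ∧-split e =
  ℕP.<ᵇ⇒< _ _ (subst T (sym e₁) _) , ℕP.≤ᵇ⇒≤ _ _ (subst T (sym e₂) _)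

edgeᵇ-complete : ∀ {n} (a : AreaSeq n) j i → Edge a j i → edgeᵇ a j i ≡ true
edgeᵇ-complete a j i (j<i , i≤j+a) = cong₂ _∧_ (T⇒≡ (ℕP.<⇒<ᵇ j<i)) (T⇒≡ (ℕP.≤⇒≤ᵇ i≤j+a))
  where
  T⇒≡ : ∀ {b} → T b → b ≡ true
  T⇒≡ {true} _ = refl

edgesFrom : ∀ {n} → AreaSeq n → Fin n → List (Fin n × Fin n)
edgesFrom {n} b j = map (j ,_) (filterᵇ (edgeᵇ b j) (allFin n))

edgeList-tabulate : ∀ {n} (b : AreaSeq n) → edgeList b ≡ concat (tabulate (edgesFrom b))
edgeList-tabulate b = cong concat (List.map-tabulate id (edgesFrom b))

module AddCorner {n : ℕ} (a : AreaSeq n) (u v : Fin n) (oc : OuterCorner a u v) where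

  private
    U V A : ℕ
    U = toℕ u
    V = toℕ v
    A = area a v

  v≡u+a+1 : V ≡ suc (U + A)
  v≡u+a+1 = ℕP.≤-antisym upper lower
    where
    lower : U + A < V
    lower = ℕP.≰⇒> (λ V≤U+A → proj₁ (proj₂ oc) (proj₁ oc , V≤U+A))
    upper : V ≤ suc (U + A)
    upper with proj₂ (proj₂ oc)
    ... | inj₁ u+1≡v = subst (_≤ suc (U + A)) u+1≡v (s≤s (ℕP.m≤m+n U A))
    ... | inj₂ (u' , v' , u'≡u+1 , v≡v'+1 , u'→v , u→v') = subst (λ z → V ≤ z + A) u'≡u+1 (proj₂ u'→v)

  -- the vertex preceding v has area at least a_v (this is where the corner condition is used)
  area-pred : ∀ i → suc (toℕ i) ≡ V → A ≤ area a i
  area-pred i i+1≡v with proj₂ (proj₂ oc)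
  ... | inj₁ u+1≡v =
    subst (_≤ area a i) (sym (ℕP.+-cancelˡ-≡ U A 0 (trans (ℕP.suc-injective (trans (sym v≡u+a+1) (sym u+1≡v)))
                                                             (sym (ℕP.+-identityʳ U))))) z≤n
  ... | inj₂ (u' , v' , u'≡u+1 , v≡v'+1 , u'→v , u→v') =
    subst (λ z → A ≤ area a z) (sym i≡v') (ℕP.+-cancelˡ-≤ U A (area a v') U+A≤U+a)
    where
    i≡v' : i ≡ v'
    i≡v' = FinP.toℕ-injective (ℕP.suc-injective (trans i+1≡v v≡v'+1))
    U+A≤U+a : U + A ≤ U + area a v'
    U+A≤U+a = subst (_≤ U + area a v') (ℕP.suc-injective (trans (sym v≡v'+1) v≡u+a+1)) (proj₂ u→v')

  area⁺ : Fin n → ℕ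
  area⁺ i = if i ==F v then suc (area a i) else area a i

  area⁺-≥ : ∀ i → area a i ≤ area⁺ i
  area⁺-≥ i with i ==F v
  ... | true  = ℕP.n≤1+n _
  ... | false = ℕP.≤-refl

  bound⁺ : ∀ i → area⁺ i ≤ toℕ i
  bound⁺ i with i ==F v in i=v
  ... | true rewrite ==F-sound i v i=v = subst (suc A ≤_) (sym v≡u+a+1) (s≤s (ℕP.m≤n+m A U))
  ... | false = bound a i

  step⁺ : ∀ i j → toℕ j ≡ suc (toℕ i) → area⁺ j ≤ suc (area⁺ i)
  step⁺ i j j≡i+1 with j ==F v in j=v | i ==F v in i=v
  ... | true  | true  rewrite ==F-sound j v j=v | ==F-sound i v i=v = ⊥-elim (ℕP.<-irrefl j≡i+1 ℕP.≤-refl)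
  ... | true  | false rewrite ==F-sound j v j=v = s≤s (area-pred i (sym j≡i+1))
  ... | false | true  rewrite ==F-sound i v i=v = ℕP.≤-trans (step a v j j≡i+1) (ℕP.n≤1+n _)
  ... | false | false = step a i j j≡i+1

  a⁺ : AreaSeq n
  a⁺ = record { area = area⁺ ; bound = bound⁺ ; step = step⁺ }

  edge-mono : ∀ x y → Edge a x y → Edge a⁺ x y
  edge-mono x y (x<y , y≤x+a) = x<y , ℕP.≤-trans y≤x+a (ℕP.+-monoʳ-≤ (toℕ x) (area⁺-≥ y))

  edge-back : ∀ x y → Edge a⁺ x y → ¬ (x ≡ u × y ≡ v) → Edge a x y
  edge-back x y (x<y , y≤x+a) x,y≢u,v with y ==F v in y=v
  ... | false = x<y , y≤x+a
  ... | true rewrite ==F-sound y v y=v = x<y , shrink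
    where
    -- V ≤ X + A + 1 with V = U + A + 1 and X ≠ U forces V ≤ X + A
    shrink : V ≤ toℕ x + A
    shrink with ℕP.m≤n⇒m<n∨m≡n (subst (V ≤_) (ℕP.+-suc (toℕ x) A) y≤x+a)
    ... | inj₁ V<x+A+1 = ℕP.≤-pred V<x+A+1
    ... | inj₂ V≡x+A+1 = ⊥-elim (x,y≢u,v (FinP.toℕ-injective
            (sym (ℕP.+-cancelʳ-≡ A U (toℕ x) (ℕP.suc-injective (trans (sym v≡u+a+1) V≡x+A+1)))) , refl))

  edge-new : Edge a⁺ u v
  edge-new = proj₁ oc , subst (V ≤_) (sym (cong (λ z → U + z) area⁺-v)) (ℕP.≤-reflexive (trans v≡u+a+1 (sym (ℕP.+-suc U A))))
    where
    area⁺-v : area⁺ v ≡ suc A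
    area⁺-v rewrite ==F-refl v = refl

  edgeᵇ-same : ∀ x y → ¬ (x ≡ u × y ≡ v) → edgeᵇ a⁺ x y ≡ edgeᵇ a x y
  edgeᵇ-same x y ne = bool-ext (λ e → edgeᵇ-complete a x y (edge-back x y (edgeᵇ-sound a⁺ x y e) ne))
                              (λ e → edgeᵇ-complete a⁺ x y (edge-mono x y (edgeᵇ-sound a x y e)))

  edgeList-↭ : edgeList a⁺ ↭ (u , v) ∷ edgeList a
  edgeList-↭ rewrite edgeList-tabulate a⁺ | edgeList-tabulate a =
    concat-point n (edgesFrom a⁺) (edgesFrom a) u (u , v)
      (λ j j≠u → ↭-reflexive (cong (map (j ,_)) (filter-tabulate-cong n id
         (λ y → edgeᵇ-same j y (λ (j≡u , _) → ==F-false j u j≠u j≡u)))))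
      (map⁺ (u ,_) (filter-point n id (edgeᵇ a u) (edgeᵇ a⁺ u) v
         (λ y y≠v → sym (edgeᵇ-same u y (λ (_ , y≡v) → ==F-false y v y≠v y≡v)))
         (edgeᵇ-complete a⁺ u v edge-new)
         (BoolP.¬-not (λ e → proj₁ (proj₂ oc) (edgeᵇ-sound a u v e)))))

  corner-preserved : ∀ x y → OuterCorner a x y → ¬ (x ≡ u × y ≡ v) → OuterCorner a⁺ x y
  corner-preserved x y (x<y , ¬x→y , inj₁ x+1≡y) ne =
    x<y , (λ x→y → ¬x→y (edge-back x y x→y ne)) , inj₁ x+1≡y
  corner-preserved x y (x<y , ¬x→y , inj₂ (x' , y' , x'≡x+1 , y≡y'+1 , x'→y , x→y')) ne =
    x<y , (λ x→y → ¬x→y (edge-back x y x→y ne)) ,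
    inj₂ (x' , y' , x'≡x+1 , y≡y'+1 , edge-mono x' y x'→y , edge-mono x y' x→y')

isPair : ∀ {n} → Fin n → Fin n → Fin n → Fin n → Bool
isPair u v x y = (u ==F x) ∧ (v ==F y)

isPair-sound : ∀ {n} (u v x y : Fin n) → isPair u v x y ≡ true → x ≡ u × y ≡ v
isPair-sound u v x y e with e₁ , e₂ ← ∧-split e = sym (==F-sound u x e₁) , sym (==F-sound v y e₂)

_∖[_,_] : ∀ {n} → Rel n → Fin n → Fin n → Rel n
(s ∖[ u , v ]) x y = s x y ∧ not (isPair u v x y)

∖-⊆ : ∀ {n} (s : Rel n) u v x y → (s ∖[ u , v ]) x y ≡ true → s x y ≡ true
∖-⊆ s u v x y e = proj₁ (∧-split e)

∖-off : ∀ {n} (s : Rel n) u v x y → isPair u v x y ≡ false → (s ∖[ u , v ]) x y ≡ s x y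
∖-off s u v x y e rewrite e = BoolP.∧-identityʳ (s x y)

∖-ne : ∀ {n} (s : Rel n) u v x y → (s ∖[ u , v ]) x y ≡ true → ¬ (x ≡ u × y ≡ v)
∖-ne s u v .u .v e (refl , refl) rewrite ==F-refl u | ==F-refl v | BoolP.∧-zeroʳ (s u v) with () ← e

Gpoly : ∀ {n} → AreaSeq n → Rel n → ∀ {N} → (Fin N → ℕ) → Poly
Gpoly {n} a s {N} α =
  ΣP (map (λ κ → qPow (ascκ a κ)) (filterᵇ (λ κ → respectsStrict s κ ∧ contentIs κ α) (allFuns n N)))

Lshift : ∀ {n} → AreaSeq n → Rel n → ∀ {N} → (Fin N → ℕ) → Poly
Lshift a s α = ΣP (map (λ θ → scale (+ eπCoeff s θ α) (qPow (ascθ θ))) (orientations a))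

Lpoly : ∀ {n} → AreaSeq n → Rel n → ∀ {N} → (Fin N → ℕ) → Poly
Lpoly a s α = atQ-1 (Lshift a s α)

Agrees : ∀ {n} → AreaSeq n → Rel n → Set
Agrees a s = ∀ {N} (α : Fin N → ℕ) → coeff (Gpoly a s α) ≗ coeff (Lpoly a s α)

reachIn-cong : ∀ {n} k {st st' : Rel n} → st ≗R st' → ∀ x w → reachIn k st x w ≡ reachIn k st' x w
reachIn-cong zero    e x w = refl
reachIn-cong {n} (suc k) e x w =
  cong₂ _∨_ (reachIn-cong k e x w) (any-cong (allFin n) (λ y → cong₂ _∧_ (e x y) (reachIn-cong k e y w)))

hrv-cong : ∀ {n} {s s' : Rel n} {θ θ'} → stepθ s θ ≗R stepθ s' θ' → ∀ x → hrv s θ x ≡ hrv s' θ' x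
hrv-cong {n} e x =
  cong (foldr _⊔_ 0) (List.map-cong (λ w → cong (λ b → if b then toℕ w else 0) (reachIn-cong n e x w)) (allFin n))

increasingOnBlocks : ∀ {n N} → (Fin n → ℕ) → (Fin N → ℕ) → (Fin n → Fin N) → Bool
increasingOnBlocks {n} h α κ = contentIs κ α ∧
  all (λ x → all (λ y → not ((toℕ x <ᵇ toℕ y) ∧ (h x ≡ᵇ h y)) ∨ (toℕ (κ x) <ᵇ toℕ (κ y))) (allFin n)) (allFin n)

eπ-cong : ∀ {n} {s s' : Rel n} {θ θ'} → stepθ s θ ≗R stepθ s' θ' →
  ∀ {N} (α : Fin N → ℕ) → eπCoeff s θ α ≡ eπCoeff s' θ' α
eπ-cong {n} {s} {s'} {θ} {θ'} e {N} α =
  countᵇ-cong {p = increasingOnBlocks (hrv s θ) α} {q = increasingOnBlocks (hrv s' θ') α} same (allFuns n N)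
  where
  same : ∀ κ → increasingOnBlocks (hrv s θ) α κ ≡ increasingOnBlocks (hrv s' θ') α κ
  same κ = cong (contentIs κ α ∧_) (all-cong (allFin n) λ x → all-cong (allFin n) λ y →
    cong (λ b → not ((toℕ x <ᵇ toℕ y) ∧ b) ∨ (toℕ (κ x) <ᵇ toℕ (κ y)))
         (cong₂ _≡ᵇ_ (hrv-cong {s = s} {s'} {θ} {θ'} e x) (hrv-cong {s = s} {s'} {θ} {θ'} e y)))

stepθ-cong : ∀ {n} {s s' : Rel n} → s ≗R s' → ∀ θ → stepθ s θ ≗R stepθ s' θ
stepθ-cong e θ x y = cong (_∨ _) (e x y)

stepθ-↭ : ∀ {n} (s : Rel n) {θ θ' : Orientation n} → θ ↭ θ' → stepθ s θ ≗R stepθ s θ'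
stepθ-↭ s θ↭θ' x y = cong (s x y ∨_) (any-↭ _ θ↭θ')

Gpoly-cong : ∀ {n} (a : AreaSeq n) {s s' : Rel n} → s ≗R s' → ∀ {N} (α : Fin N → ℕ) → Gpoly a s α ≡ Gpoly a s' α
Gpoly-cong {n} a e {N} α = cong (λ l → ΣP (map (λ κ → qPow (ascκ a κ)) l))
  (filterᵇ-cong (λ κ → cong (_∧ contentIs κ α)
     (all-cong (allFin n) λ x → all-cong (allFin n) λ y → cong (λ b → not b ∨ (toℕ (κ x) <ᵇ toℕ (κ y))) (e x y)))
     (allFuns n N))

Lshift-cong : ∀ {n} (a : AreaSeq n) {s s' : Rel n} → s ≗R s' → ∀ {N} (α : Fin N → ℕ) → Lshift a s α ≡ Lshift a s' α
Lshift-cong a {s} {s'} e α = cong ΣP (List.map-cong (λ θ → cong (λ c → scale (+ c) (qPow (ascθ θ)))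
  (eπ-cong {s = s} {s'} {θ} {θ} (stepθ-cong e θ) α)) (orientations a))

-- A term q^m, counted when r ∧ c, whose exponent grows by one when l holds: since
-- q^{m+1} = q^m + (q - 1) q^m, this adds (q - 1) q^m on the terms where r ∧ l ∧ c.
indicator-step : ∀ r c l m k →
  (if r ∧ c then coeff (qPow (if l then suc m else m)) k else + 0) ≡
  (if r ∧ c then coeff (qPow m) k else + 0) +ℤ Δ (λ j → if (r ∧ l) ∧ c then coeff (qPow m) j else + 0) k
indicator-step false c     l     m k = sym (trans (ℤP.+-identityˡ _) (Additive.T-0 Δ-additive k))
indicator-step true  false l     m k rewrite BoolP.∧-zeroʳ l = sym (trans (ℤP.+-identityˡ _) (Additive.T-0 Δ-additive k))
indicator-step true  true  true  m k = trans (coeff-0∷ (qPow m) k) (q·-split (coeff (qPow m)) k)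
indicator-step true  true  false m k = sym (trans (cong (coeff (qPow m) k +ℤ_) (Additive.T-0 Δ-additive k)) (ℤP.+-identityʳ _))

module Recurrence {n : ℕ} (a : AreaSeq n) (u v : Fin n) (oc : OuterCorner a u v)
                  (s : Rel n) (suv : s u v ≡ true) {N : ℕ} (α : Fin N → ℕ) where

  open AddCorner a u v oc

  s⁻ : Rel n
  s⁻ = s ∖[ u , v ]

  ascends : (Fin n → Fin N) → Bool
  ascends κ = toℕ (κ u) <ᵇ toℕ (κ v)

  respects-split : ∀ κ → respectsStrict s κ ≡ respectsStrict s⁻ κ ∧ ascends κ
  respects-split κ = bool-ext to from
    where
    to : respectsStrict s κ ≡ true → respectsStrict s⁻ κ ∧ ascends κ ≡ true
    to e = cong₂ _∧_ (respects-complete s⁻ κ (λ x y e' → R x y (∖-⊆ s u v x y e'))) (R u v suv)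
      where R = respects-sound s κ e
    from : respectsStrict s⁻ κ ∧ ascends κ ≡ true → respectsStrict s κ ≡ true
    from e with r , l ← ∧-split e = respects-complete s κ R
      where
      R : Respects s κ
      R x y sxy with isPair u v x y in pair
      ... | true with refl , refl ← isPair-sound u v x y pair = l
      ... | false = respects-sound s⁻ κ r x y (trans (∖-off s u v x y pair) sxy)

  asc-split : ∀ κ → ascκ a⁺ κ ≡ (if ascends κ then suc (ascκ a κ) else ascκ a κ)
  asc-split κ = trans (countᵇ-↭ _ edgeList-↭) (countᵇ-∷ _ (u , v) (edgeList a))

  Gterm : AreaSeq n → Rel n → (Fin n → Fin N) → ℕ → ℤ
  Gterm b t κ k = if respectsStrict t κ ∧ contentIs κ α then coeff (qPow (ascκ b κ)) k else + 0

  coeff-Gpoly : ∀ b t k → coeff (Gpoly b t α) k ≡ sumOver (allFuns n N) (λ κ → Gterm b t κ k)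
  coeff-Gpoly b t k =
    trans (coeff-ΣP (λ κ → qPow (ascκ b κ)) (filterᵇ (λ κ → respectsStrict t κ ∧ contentIs κ α) (allFuns n N)) k)
          (sum-filter (λ κ → respectsStrict t κ ∧ contentIs κ α) (allFuns n N) (λ κ → coeff (qPow (ascκ b κ)) k))

  Gterm-split : ∀ κ k → Gterm a⁺ s⁻ κ k ≡ Gterm a s⁻ κ k +ℤ Δ (λ j → Gterm a s κ j) k
  Gterm-split κ k = begin
    Gterm a⁺ s⁻ κ k
      ≡⟨ cong (λ m → gate (coeff (qPow m) k)) (asc-split κ) ⟩
    gate (coeff (qPow (if ascends κ then suc (ascκ a κ) else ascκ a κ)) k)
      ≡⟨ indicator-step (respectsStrict s⁻ κ) (contentIs κ α) (ascends κ) (ascκ a κ) k ⟩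
    Gterm a s⁻ κ k +ℤ Δ (λ j → if (respectsStrict s⁻ κ ∧ ascends κ) ∧ contentIs κ α then coeff (qPow (ascκ a κ)) j else + 0) k
      ≡⟨ cong (Gterm a s⁻ κ k +ℤ_) (Δ-cong (λ j →
           cong (λ b → if b ∧ contentIs κ α then coeff (qPow (ascκ a κ)) j else + 0) (sym (respects-split κ))) k) ⟩
    Gterm a s⁻ κ k +ℤ Δ (λ j → Gterm a s κ j) k ∎
    where
    gate : ℤ → ℤ
    gate x = if respectsStrict s⁻ κ ∧ contentIs κ α then x else + 0

  G-recurrence : ∀ k → coeff (Gpoly a⁺ s⁻ α) k ≡ coeff (Gpoly a s⁻ α) k +ℤ Δ (coeff (Gpoly a s α)) k
  G-recurrence k = begin
    coeff (Gpoly a⁺ s⁻ α) k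
      ≡⟨ coeff-Gpoly a⁺ s⁻ k ⟩
    sumOver κs (λ κ → Gterm a⁺ s⁻ κ k)
      ≡⟨ sum-cong κs (λ κ → Gterm-split κ k) ⟩
    sumOver κs (λ κ → Gterm a s⁻ κ k +ℤ Δ (Gterm a s κ) k)
      ≡⟨ sum-+ κs (λ κ → Gterm a s⁻ κ k) (λ κ → Δ (Gterm a s κ) k) ⟩
    sumOver κs (λ κ → Gterm a s⁻ κ k) +ℤ sumOver κs (λ κ → Δ (Gterm a s κ) k)
      ≡⟨ cong₂ _+ℤ_ (sym (coeff-Gpoly a s⁻ k)) (sum-commute Δ-additive κs (Gterm a s) k) ⟩
    coeff (Gpoly a s⁻ α) k +ℤ Δ (λ j → sumOver κs (λ κ → Gterm a s κ j)) k
      ≡⟨ cong (coeff (Gpoly a s⁻ α) k +ℤ_) (Δ-cong (λ j → sym (coeff-Gpoly a s j)) k) ⟩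
    coeff (Gpoly a s⁻ α) k +ℤ Δ (coeff (Gpoly a s α)) k ∎
    where κs = allFuns n N

  Lterm : Rel n → ℕ → Orientation n → ℤ
  Lterm t k θ = coeff (scale (+ eπCoeff t θ α) (qPow (ascθ θ))) k

  coeff-Lshift : ∀ b t k → coeff (Lshift b t α) k ≡ labelSum (edgeList b) (Lterm t k)
  coeff-Lshift b t k = coeff-ΣP (λ θ → scale (+ eπCoeff t θ α) (qPow (ascθ θ))) (orientations b) k

  Lterm-invariant : ∀ t k → PermInvariant (Lterm t k)
  Lterm-invariant t k {θ} {θ'} θ↭θ' = cong₂ (λ c m → coeff (scale (+ c) (qPow m)) k)
    (eπ-cong {s = t} {t} {θ} {θ'} (stepθ-↭ t θ↭θ') α) (countᵇ-↭ proj₂ θ↭θ')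

  -- orienting the new edge v → u leaves the step relation of s⁻ unchanged
  eπ-descending : ∀ r → eπCoeff s⁻ (((u , v) , false) ∷ r) α ≡ eπCoeff s⁻ r α
  eπ-descending r = eπ-cong {s = s⁻} {s⁻} {((u , v) , false) ∷ r} {r} (λ x y → refl) α

  -- orienting it u → v makes it act exactly like the strict edge (u , v) of s
  eπ-ascending : ∀ r → eπCoeff s⁻ (((u , v) , true) ∷ r) α ≡ eπCoeff s r α
  eπ-ascending r = eπ-cong {s = s⁻} {s} {((u , v) , true) ∷ r} {r} same α
    where
    same : stepθ s⁻ (((u , v) , true) ∷ r) ≗R stepθ s r
    same x y with isPair u v x y in pair
    ... | true with refl , refl ← isPair-sound u v x y pair = trans (BoolP.∨-zeroʳ _) (sym (cong (_∨ _) suv))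
    ... | false = cong (_∨ _) (BoolP.∧-identityʳ (s x y))

  Lterm-split : ∀ k r → Lterm s⁻ k (((u , v) , true) ∷ r) +ℤ Lterm s⁻ k (((u , v) , false) ∷ r)
                       ≡ Lterm s⁻ k r +ℤ q· (λ j → Lterm s j r) k
  Lterm-split k r = trans (ℤP.+-comm (Lterm s⁻ k (((u , v) , true) ∷ r)) (Lterm s⁻ k (((u , v) , false) ∷ r)))
   (cong₂ _+ℤ_
    (cong (λ c → coeff (scale (+ c) (qPow (ascθ r))) k) (eπ-descending r))
    (trans (cong (λ c → coeff (scale (+ c) (+ 0 ∷ qPow (ascθ r))) k) (eπ-ascending r))
           (coeff-scale-0∷ (+ eπCoeff s r α) (qPow (ascθ r)) k)))

  Lshift-recurrence : ∀ k → coeff (Lshift a⁺ s⁻ α) k ≡ coeff (Lshift a s⁻ α) k +ℤ q· (coeff (Lshift a s α)) k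
  Lshift-recurrence k = begin
    coeff (Lshift a⁺ s⁻ α) k
      ≡⟨ coeff-Lshift a⁺ s⁻ k ⟩
    labelSum (edgeList a⁺) (Lterm s⁻ k)
      ≡⟨ labelSum-↭ edgeList-↭ (Lterm s⁻ k) (Lterm-invariant s⁻ k) ⟩
    labelSum ((u , v) ∷ edgeList a) (Lterm s⁻ k)
      ≡⟨ labelSum-∷ (u , v) (edgeList a) (Lterm s⁻ k) ⟩
    labelSum (edgeList a) (λ r → Lterm s⁻ k (((u , v) , true) ∷ r) +ℤ Lterm s⁻ k (((u , v) , false) ∷ r))
      ≡⟨ sum-cong θs (Lterm-split k) ⟩
    labelSum (edgeList a) (λ r → Lterm s⁻ k r +ℤ q· (λ j → Lterm s j r) k)
      ≡⟨ sum-+ θs (Lterm s⁻ k) (λ r → q· (λ j → Lterm s j r) k) ⟩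
    labelSum (edgeList a) (Lterm s⁻ k) +ℤ sumOver θs (λ r → q· (λ j → Lterm s j r) k)
      ≡⟨ cong₂ _+ℤ_ (sym (coeff-Lshift a s⁻ k)) (sum-commute q·-additive θs (λ r j → Lterm s j r) k) ⟩
    coeff (Lshift a s⁻ α) k +ℤ q· (λ j → labelSum (edgeList a) (Lterm s j)) k
      ≡⟨ cong (coeff (Lshift a s⁻ α) k +ℤ_) (q·-cong (λ j → sym (coeff-Lshift a s j)) k) ⟩
    coeff (Lshift a s⁻ α) k +ℤ q· (coeff (Lshift a s α)) k ∎
    where θs = orientations a

  L-recurrence : ∀ k → coeff (Lpoly a⁺ s⁻ α) k ≡ coeff (Lpoly a s⁻ α) k +ℤ Δ (coeff (Lpoly a s α)) k
  L-recurrence k = begin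
    coeff (atQ-1 (Lshift a⁺ s⁻ α)) k
      ≡⟨ atQ-1-cong (Lshift a⁺ s⁻ α) (Lshift a s⁻ α ⊕ (+ 0 ∷ Lshift a s α)) (λ j →
           trans (Lshift-recurrence j)
                 (sym (trans (coeff-⊕ (Lshift a s⁻ α) (+ 0 ∷ Lshift a s α) j)
                             (cong (coeff (Lshift a s⁻ α) j +ℤ_) (coeff-0∷ (Lshift a s α) j))))) k ⟩
    coeff (atQ-1 (Lshift a s⁻ α ⊕ (+ 0 ∷ Lshift a s α))) k
      ≡⟨ atQ-1-⊕ (Lshift a s⁻ α) (+ 0 ∷ Lshift a s α) k ⟩
    coeff (Lpoly a s⁻ α) k +ℤ coeff (atQ-1 (+ 0 ∷ Lshift a s α)) k
      ≡⟨ cong (coeff (Lpoly a s⁻ α) k +ℤ_) (atQ-1-q· (Lshift a s α) k) ⟩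
    coeff (Lpoly a s⁻ α) k +ℤ Δ (coeff (Lpoly a s α)) k ∎

agrees-step : ∀ {n} (a : AreaSeq n) u v (oc : OuterCorner a u v) (s : Rel n) (suv : s u v ≡ true) →
  Agrees a (s ∖[ u , v ]) → Agrees (AddCorner.a⁺ a u v oc) (s ∖[ u , v ]) → Agrees a s
agrees-step a u v oc s suv agrees⁻ agrees⁺ α = Δ-injective _ _ λ k →
  ∙-cancelˡ (coeff (Gpoly a s⁻ α) k) (Δ (coeff (Gpoly a s α)) k) (Δ (coeff (Lpoly a s α)) k) (begin
    coeff (Gpoly a s⁻ α) k +ℤ Δ (coeff (Gpoly a s α)) k  ≡⟨ G-recurrence k ⟨
    coeff (Gpoly a⁺ s⁻ α) k                              ≡⟨ agrees⁺ α k ⟩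
    coeff (Lpoly a⁺ s⁻ α) k                              ≡⟨ L-recurrence k ⟩
    coeff (Lpoly a s⁻ α) k +ℤ Δ (coeff (Lpoly a s α)) k  ≡⟨ cong (_+ℤ Δ (coeff (Lpoly a s α)) k) (agrees⁻ α k) ⟨
    coeff (Gpoly a s⁻ α) k +ℤ Δ (coeff (Lpoly a s α)) k  ∎)
  where
  open AddCorner a u v oc using (a⁺)
  open Recurrence a u v oc s suv α

CornersOf : ∀ {n} → AreaSeq n → Rel n → Set
CornersOf a s = ∀ x y → s x y ≡ true → OuterCorner a x y

-- Induction on a list P containing all pairs of s; the base case s = ∅ is the hypothesis.
agrees-by-induction : (∀ (n : ℕ) (a : AreaSeq n) → G≡L a (emptyStrict a)) →
  ∀ {n} (P : List (Fin n × Fin n)) (a : AreaSeq n) (s : Rel n) →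
  CornersOf a s → (∀ x y → s x y ≡ true → (x , y) ∈ P) → Agrees a s
agrees-by-induction unit {n} [] a s _ s⊆[] α k = begin
  coeff (Gpoly a s α) k                ≡⟨ cong (λ p → coeff p k) (Gpoly-cong a s≗∅ α) ⟩
  coeff (Gpoly a (λ _ _ → false) α) k  ≡⟨ unit n a _ α k ⟩
  coeff (Lpoly a (λ _ _ → false) α) k  ≡⟨ cong (λ p → coeff (atQ-1 p) k) (Lshift-cong a s≗∅ α) ⟨
  coeff (Lpoly a s α) k                ∎
  where
  s≗∅ : s ≗R (λ _ _ → false)
  s≗∅ x y with s x y in sxy
  ... | true with () ← s⊆[] x y sxy
  ... | false = refl
agrees-by-induction unit ((u , v) ∷ P) a s corners s⊆uv∷P with s u v in suv
... | false = agrees-by-induction unit P a s corners s⊆P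
  where
  s⊆P : ∀ x y → s x y ≡ true → (x , y) ∈ P
  s⊆P x y sxy with s⊆uv∷P x y sxy
  ... | here refl with () ← trans (sym sxy) suv
  ... | there xy∈P = xy∈P
... | true = agrees-step a u v oc s suv
  (agrees-by-induction unit P a s⁻ (λ x y e → corners x y (∖-⊆ s u v x y e)) s⁻⊆P)
  (agrees-by-induction unit P a⁺ s⁻
     (λ x y e → corner-preserved x y (corners x y (∖-⊆ s u v x y e)) (∖-ne s u v x y e)) s⁻⊆P)
  where
  oc = corners u v suv
  open AddCorner a u v oc using (a⁺; corner-preserved)
  s⁻ = s ∖[ u , v ]
  s⁻⊆P : ∀ x y → s⁻ x y ≡ true → (x , y) ∈ P
  s⁻⊆P x y e with s⊆uv∷P x y (∖-⊆ s u v x y e)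
  ... | here refl with () ← ∖-ne s u v x y e (refl , refl)
  ... | there xy∈P = xy∈P

corollary4p3 : (∀ (n : ℕ) (a : AreaSeq n) → G≡L a (emptyStrict a))
    → ∀ (n : ℕ) (a : AreaSeq n) (s : StrictSet a) → G≡L a s
corollary4p3 unit n a (s , corners) N α =
  agrees-by-induction unit (cartesianProduct (allFin n) (allFin n)) a s corners
    (λ x y _ → ∈-cartesianProduct⁺ (∈-allFin x) (∈-allFin y)) α
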